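{- There is a constant $c>0$ such that for every $n\ge 2$ and every graph $G$ on $n$ vertices, there is a CNF formula $F$ that encodes the independent-set property of $G$ and has $|F|\le c\, n^2/\log_2 n$ clauses; i.e., $|F| = O(n^2/\log n)$.
   Context: Formulas are CNF formulas (sets of clauses); $|F|$ is the number of clauses. For a formula $F$ and an assignment $\tau$ to some of its variables, $F|_\tau$ is obtained by deleting every clause satisfied by $\tau$ and deleting from the remaining clauses every literal falsified by $\tau$. Given a graph $G=(V,E)$, variables $X=\{x_v : v\in V\}$ and a (possibly empty) set $Y$ of auxiliary variables, a formula $F$ with variable set $X\cup Y$ encodes the independent-set property of $G$ if for every assignment $\tau: X\to\{\bot,\top\}$, $F|_\tau$ is satisfiable if and only if $\{v\in V : \tau(x_v)=\top\}$ is an independent set of $G$. -}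

module Defs where

open import Data.Bool using (Bool; true; false; not; if_then_else_)
open import Data.Nat using (ℕ)
open import Data.Fin using (Fin)
open import Data.Sum using (_⊎_; inj₁; inj₂)
open import Data.Product using (_×_; _,_; ∃-syntax)
open import Data.List using (List; []; _∷_; mapMaybe)
open import Data.List.Relation.Unary.All using (All)
open import Data.List.Relation.Unary.Any using (Any)
open import Data.Maybe using (Maybe; just; nothing)
import Data.Maybe as Maybe
open import Data.Empty using (⊥)
open import Relation.Binary.PropositionalEquality using (_≡_)
open import Function.Bundles using (_⇔_)

Lit : Set → Set
Lit V = V × Bool

Clause : Set → Set
Clause V = List (Lit V)

-- A CNF formula; |F| is the number of clauses (its length).
CNF : Set → Set
CNF V = List (Clause V)

litVal : {V : Set} → (V → Bool) → Lit V → Bool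
litVal α (v , true)  = α v
litVal α (v , false) = not (α v)

Satisfies : {V : Set} → (V → Bool) → CNF V → Set
Satisfies α F = All (λ C → Any (λ l → litVal α l ≡ true) C) F

Satisfiable : {V : Set} → CNF V → Set
Satisfiable {V} F = ∃[ α ] Satisfies {V} α F

-- Restriction of a clause over X ⊎ Y by τ : X → Bool.
-- nothing  = the clause is satisfied by τ (deleted);
-- just C'  = C with the literals falsified by τ removed.
restrictClause : {X Y : Set} → (X → Bool) → Clause (X ⊎ Y) → Maybe (Clause Y)
restrictClause τ [] = just []
restrictClause τ ((inj₁ x , p) ∷ C) =
  if litVal τ (x , p) then nothing else restrictClause τ C
restrictClause τ ((inj₂ y , p) ∷ C) =
  Maybe.map ((y , p) ∷_) (restrictClause τ C)

restrict : {X Y : Set} → (X → Bool) → CNF (X ⊎ Y) → CNF Y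
restrict τ F = mapMaybe (restrictClause τ) F

Adj : ℕ → Set
Adj n = Fin n → Fin n → Bool

IsSimpleGraph : {n : ℕ} → Adj n → Set
IsSimpleGraph {n} E =
  ((u v : Fin n) → E u v ≡ E v u) × ((v : Fin n) → E v v ≡ false)

IsIndependent : {n : ℕ} → Adj n → (Fin n → Bool) → Set
IsIndependent {n} E S =
  (u v : Fin n) → E u v ≡ true → S u ≡ true → S v ≡ true → ⊥

EncodesIS : {n m : ℕ} → Adj n → CNF (Fin n ⊎ Fin m) → Set
EncodesIS {n} E F =
  (τ : Fin n → Bool) → Satisfiable (restrict τ F) ⇔ IsIndependent E τ

-- Split the vertices into B ≈ n / k blocks of k ≈ ½ log₂ n vertices. For every block i and every
-- pattern T ⊆ Fin k take an auxiliary variable y(i,T), forced by the clauses ¬x(block i j) ∨ y(i,T)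
-- (j ∈ T) to hold whenever the chosen set meets block i inside T. For a vertex v and a block i let
-- T be the positions of v's neighbours in block i; the clause ¬y(i,T) ∨ ¬x(v) then forbids choosing
-- v together with any of them, and every edge is caught this way in the block of its other end.
-- Conversely an independent set satisfies all clauses once y(i,T) is read as "the set meets block i
-- inside T". Since 2^k = O(√n), there are B·2^k·k + B·n = O(n^{3/2} + n² / log n) clauses.

{-# OPTIONS --safe #-}
module Submission where

open import Defs
open import Data.Bool using (Bool; true; false; not; if_then_else_; _≟_)
open import Data.Nat using (ℕ; zero; suc; _+_; _*_; _^_; _≤_; _<_; z≤n; s≤s; ⌊_/2⌋; ⌈_/2⌉; NonZero)
open import Data.Nat.Properties
  using ( ≤-refl; ≤-reflexive; ≤-trans; <⇒≤; n≤1+n; module ≤-Reasoning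
        ; +-comm; +-suc; +-identityʳ; *-assoc; +-monoʳ-≤; +-mono-≤; +-monoˡ-<; *-monoˡ-≤; *-monoʳ-≤; *-mono-≤
        ; m≤m*n; m^n>0; m^n≢0; ^-distribˡ-+-*; ^-monoʳ-≤; ⌊n/2⌋-mono; ⌊n/2⌋≤⌈n/2⌉; ⌊n/2⌋+⌈n/2⌉≡n)
open import Data.Nat.DivMod using (_/_; _%_; _mod_; m≡m%n+[m/n]*n; m%n<n; m/n*n≤m; m<n⇒m%n≡m)
open import Data.Nat.Logarithm using (⌊log₂_⌋)
open import Data.Nat.Logarithm.Core using (⌊log2⌋)
open import Data.Nat.Tactic.RingSolver using (solve-∀)
open import Data.Fin using (Fin; toℕ; inject≤; combine; remQuot; finToFun; funToFin)
open import Data.Fin.Properties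
  using (remQuot-combine; combine-remQuot; toℕ<n; toℕ-inject≤; fromℕ<-cong; fromℕ<-toℕ; finToFun-funToFin; 2↔Bool; any?)
open import Data.Sum using (_⊎_; inj₁; inj₂; [_,_]′)
open import Data.Product using (_×_; _,_; ∃-syntax; ∃₂; proj₁; proj₂; uncurry)
open import Data.List using (List; []; _∷_; length; tabulate; _++_)
open import Data.List.Properties using (length-++; length-tabulate)
open import Data.List.Relation.Unary.All as All using (All; []; _∷_)
open import Data.List.Relation.Unary.All.Properties using (All¬⇒¬Any; mapMaybe⁺; map⁺; tabulate⁺; tabulate⁻; ++⁺; ++⁻)
open import Data.List.Relation.Unary.Any using (Any; here; there)
import Data.Maybe.Relation.Unary.All as Maybe
open Maybe using (just; nothing)
open import Data.Maybe using (just; nothing)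
open import Data.Empty using (⊥)
open import Function using (_∘_)
open import Function.Bundles using (_⇔_; mk⇔; Equivalence; Inverse)
open import Induction.WellFounded using (Acc; acc)
open import Relation.Binary.PropositionalEquality using (_≡_; refl; sym; trans; cong; cong₂; subst; module ≡-Reasoning)
open import Relation.Nullary using (¬_; Dec; does; contradiction)
open import Relation.Nullary.Decidable using (dec-true; dec-false; _×-dec_)

open Equivalence using (to; from)

neg pos : {V : Set} → V → Lit V
neg v = v , false
pos v = v , true

SatisfiesClause : {V : Set} → (V → Bool) → Clause V → Set
SatisfiesClause β C = Any (λ l → litVal β l ≡ true) C

litVal-∘ : {V W : Set} (β : V → Bool) (f : W → V) (w : W) (p : Bool) →
           litVal (β ∘ f) (w , p) ≡ litVal β (f w , p)
litVal-∘ β f w true  = refl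
litVal-∘ β f w false = refl

falsified⇒¬satisfied : {V : Set} {β : V → Bool} {C : Clause V} →
                       All (λ l → litVal β l ≡ false) C → ¬ SatisfiesClause β C
falsified⇒¬satisfied = All¬⇒¬Any ∘ All.map λ l≡false l≡true → contradiction (trans (sym l≡false) l≡true) λ ()

module _ {X Y : Set} (τ : X → Bool) (α : Y → Bool) where

  restrictClause⁺ : ∀ C → SatisfiesClause [ τ , α ]′ C →
                    Maybe.All (SatisfiesClause α) (restrictClause τ C)
  restrictClause⁺ ((inj₁ x , p) ∷ C) sat with litVal τ (x , p) in τx | sat
  ... | true  | _         = nothing
  ... | false | here σx   = contradiction (trans (sym τx) (trans (litVal-∘ [ τ , α ]′ inj₁ x p) σx)) λ ()
  ... | false | there sat = restrictClause⁺ C sat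
  restrictClause⁺ ((inj₂ y , p) ∷ C) sat with restrictClause τ C | restrictClause⁺ C | sat
  ... | nothing | _  | _         = nothing
  ... | just _  | _  | here σy   = just (here (trans (litVal-∘ [ τ , α ]′ inj₂ y p) σy))
  ... | just _  | ih | there sat with ih sat
  ...   | just satD = just (there satD)

  restrictClause⁻ : ∀ C → Maybe.All (SatisfiesClause α) (restrictClause τ C) →
                    SatisfiesClause [ τ , α ]′ C
  restrictClause⁻ [] (just ())
  restrictClause⁻ ((inj₁ x , p) ∷ C) sat with litVal τ (x , p) in τx
  ... | true  = here (trans (sym (litVal-∘ [ τ , α ]′ inj₁ x p)) τx)
  ... | false = there (restrictClause⁻ C sat)
  restrictClause⁻ ((inj₂ y , p) ∷ C) sat with restrictClause τ C | restrictClause⁻ C | sat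
  ... | nothing | ih | nothing           = there (ih nothing)
  ... | just _  | _  | just (here αy)    = here (trans (sym (litVal-∘ [ τ , α ]′ inj₂ y p)) αy)
  ... | just _  | ih | just (there satD) = there (ih (just satD))

  restrict⁺ : ∀ F → Satisfies [ τ , α ]′ F → Satisfies α (restrict τ F)
  restrict⁺ F = mapMaybe⁺ ∘ map⁺ ∘ All.map (λ {C} → restrictClause⁺ C)

  restrict⁻ : ∀ F → Satisfies α (restrict τ F) → Satisfies [ τ , α ]′ F
  restrict⁻ []      []  = []
  restrict⁻ (C ∷ F) sat with restrictClause τ C | restrictClause⁻ C | sat
  ... | nothing | satC | satF        = satC nothing ∷ restrict⁻ F satF
  ... | just _  | satC | satD ∷ satF = satC (just satD) ∷ restrict⁻ F satF

satisfiable-restrict : {X Y : Set} (τ : X → Bool) (F : CNF (X ⊎ Y)) →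
                       Satisfiable (restrict τ F) ⇔ (∃[ α ] Satisfies [ τ , α ]′ F)
satisfiable-restrict τ F = mk⇔ (λ (α , sat) → α , restrict⁻ τ α F sat)
                               (λ (α , sat) → α , restrict⁺ τ α F sat)

module _ {a} {A : Set a} where

  tabulate₂ : ∀ {p q} → (Fin p → Fin q → A) → List A
  tabulate₂ {p} {q} f = tabulate (uncurry f ∘ remQuot {p} q)

  tabulate₃ : ∀ {p q r} → (Fin p → Fin q → Fin r → A) → List A
  tabulate₃ {p} {q} f = tabulate₂ (uncurry f ∘ remQuot {p} q)

  length-tabulate₂ : ∀ {p q} (f : Fin p → Fin q → A) → length (tabulate₂ f) ≡ p * q
  length-tabulate₂ f = length-tabulate _

  length-tabulate₃ : ∀ {p q r} (f : Fin p → Fin q → Fin r → A) → length (tabulate₃ f) ≡ p * q * r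
  length-tabulate₃ f = length-tabulate _

  module _ {ℓ} {P : A → Set ℓ} where

    All-tabulate₂⁺ : ∀ {p q} {f : Fin p → Fin q → A} → (∀ i j → P (f i j)) → All P (tabulate₂ f)
    All-tabulate₂⁺ {p} {q} h = tabulate⁺ λ ij → h (proj₁ (remQuot {p} q ij)) (proj₂ (remQuot {p} q ij))

    All-tabulate₂⁻ : ∀ {p q} {f : Fin p → Fin q → A} → All P (tabulate₂ f) → ∀ i j → P (f i j)
    All-tabulate₂⁻ {f = f} all i j =
      subst (P ∘ uncurry f) (remQuot-combine i j) (tabulate⁻ all (combine i j))

    All-tabulate₃⁺ : ∀ {p q r} {f : Fin p → Fin q → Fin r → A} → (∀ i j l → P (f i j l)) →
                     All P (tabulate₃ f)
    All-tabulate₃⁺ {p} {q} h =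
      All-tabulate₂⁺ λ ij → h (proj₁ (remQuot {p} q ij)) (proj₂ (remQuot {p} q ij))

    All-tabulate₃⁻ : ∀ {p q r} {f : Fin p → Fin q → Fin r → A} → All P (tabulate₃ f) →
                     ∀ i j l → P (f i j l)
    All-tabulate₃⁻ {p} {q} {f = f} all i j l =
      subst (λ ij → P (uncurry f ij l)) (remQuot-combine i j)
            (All-tabulate₂⁻ {f = uncurry f ∘ remQuot {p} q} all (combine i j) l)

encode : ∀ {k} → (Fin k → Bool) → Fin (2 ^ k)
encode S = funToFin (Inverse.from 2↔Bool ∘ S)

decode : ∀ {k} → Fin (2 ^ k) → Fin k → Bool
decode t = Inverse.to 2↔Bool ∘ finToFun t

decode-encode : ∀ {k} (S : Fin k → Bool) j → decode (encode S) j ≡ S j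
decode-encode S j =
  trans (cong (Inverse.to 2↔Bool) (finToFun-funToFin _ j)) (Inverse.strictlyInverseˡ 2↔Bool (S j))

toℕ-mod : ∀ {n} .{{_ : NonZero n}} (u : Fin n) → toℕ u mod n ≡ u
toℕ-mod {n} u =
  trans (fromℕ<-cong _ _ (m<n⇒m%n≡m (toℕ<n u)) (m%n<n (toℕ u) n) (toℕ<n u)) (fromℕ<-toℕ u (toℕ<n u))

cyclicBlock : ∀ {n B k} .{{_ : NonZero n}} → Fin B → Fin k → Fin n
cyclicBlock {n} i j = toℕ (combine i j) mod n

cyclicBlock-covers : ∀ {n B k} .{{_ : NonZero n}} → n ≤ B * k →
                     ∀ u → ∃₂ λ i j → cyclicBlock {n} {B} {k} i j ≡ u
cyclicBlock-covers {n} {B} {k} n≤Bk u = proj₁ ij , proj₂ ij , (begin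
  toℕ (uncurry combine ij) mod n ≡⟨ cong (λ w′ → toℕ w′ mod n) (combine-remQuot {B} k w) ⟩
  toℕ w mod n                    ≡⟨ cong (λ m → m mod n) (toℕ-inject≤ u n≤Bk) ⟩
  toℕ u mod n                    ≡⟨ toℕ-mod u ⟩
  u                              ∎)
  where
  open ≡-Reasoning
  w : Fin (B * k)
  w = inject≤ u n≤Bk
  ij : Fin B × Fin k
  ij = remQuot {B} k w

module BlockEncoding {n B k : ℕ} (E : Adj n) (block : Fin B → Fin k → Fin n)
                     (covers : ∀ u → ∃₂ λ i j → block i j ≡ u) where

  Var : Set
  Var = Fin n ⊎ Fin (B * 2 ^ k)

  meets : Fin B → Fin (2 ^ k) → Var
  meets i t = inj₂ (combine i t)

  neighbours : Fin n → Fin B → Fin (2 ^ k)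
  neighbours v i = encode λ j → E (block i j) v

  -- Positions outside the pattern get the tautology y ∨ ¬y, so that every (i, t, j)
  -- contributes exactly one clause.
  implication : Fin B → Fin (2 ^ k) → Fin k → Clause Var
  implication i t j = if decode t j then neg (inj₁ (block i j)) ∷ pos (meets i t) ∷ []
                                    else pos (meets i t) ∷ neg (meets i t) ∷ []

  exclusion : Fin B → Fin n → Clause Var
  exclusion i v = neg (meets i (neighbours v i)) ∷ neg (inj₁ v) ∷ []

  formula : CNF Var
  formula = tabulate₃ implication ++ tabulate₂ exclusion

  length-formula : length formula ≡ B * 2 ^ k * k + B * n
  length-formula = trans (length-++ (tabulate₃ implication))
                         (cong₂ _+_ (length-tabulate₃ implication) (length-tabulate₂ exclusion))

  Satisfies-formula⇔ : {β : Var → Bool} → Satisfies β formula ⇔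
    ((∀ i t j → SatisfiesClause β (implication i t j)) × (∀ i v → SatisfiesClause β (exclusion i v)))
  Satisfies-formula⇔ = mk⇔
    (λ sat → let impl , excl = ++⁻ (tabulate₃ implication) sat in All-tabulate₃⁻ impl , All-tabulate₂⁻ excl)
    (λ (impl , excl) → ++⁺ (All-tabulate₃⁺ impl) (All-tabulate₂⁺ excl))

  module _ (τ : Fin n → Bool) where

    Hits : Fin B → Fin (2 ^ k) → Set
    Hits i t = ∃[ j ] (decode t j ≡ true × τ (block i j) ≡ true)

    hits? : ∀ i t → Dec (Hits i t)
    hits? i t = any? λ j → (decode t j ≟ true) ×-dec (τ (block i j) ≟ true)

    witness : Fin (B * 2 ^ k) → Bool
    witness y = does (hits? (proj₁ (remQuot {B} (2 ^ k) y)) (proj₂ (remQuot {B} (2 ^ k) y)))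

    witness-combine : ∀ i t → witness (combine i t) ≡ does (hits? i t)
    witness-combine i t = cong (λ (i′ , t′) → does (hits? i′ t′)) (remQuot-combine {B} i t)

    satisfies-implication : ∀ i t j → SatisfiesClause [ τ , witness ]′ (implication i t j)
    satisfies-implication i t j with decode t j in inT
    ... | false with witness (combine i t) in w
    ...   | true  = here w
    ...   | false = there (here (cong not w))
    satisfies-implication i t j | true with τ (block i j) in τu
    ...   | false = here (cong not τu)
    ...   | true  = there (here (trans (witness-combine i t) (dec-true (hits? i t) (j , inT , τu))))

    satisfies-exclusion : IsIndependent E τ → ∀ i v → SatisfiesClause [ τ , witness ]′ (exclusion i v)
    satisfies-exclusion independent i v with τ v in τv
    ... | false = there (here (cong not τv))
    ... | true  = here (cong not (trans (witness-combine i (neighbours v i))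
                                        (dec-false (hits? i (neighbours v i)) noHit)))
      where
      noHit : ¬ Hits i (neighbours v i)
      noHit (j , adjacent , τu) = independent (block i j) v (trans (sym (decode-encode _ j)) adjacent) τu τv

  module _ (τ : Fin n → Bool) (α : Fin (B * 2 ^ k) → Bool) where

    implication⇒ : ∀ {i t j} → decode t j ≡ true → SatisfiesClause [ τ , α ]′ (implication i t j) →
                   τ (block i j) ≡ true → α (combine i t) ≡ true
    implication⇒ {i} {t} {j} inT sat τu with decode t j | inT
    ... | true | refl with α (combine i t) in αy
    ...   | true  = refl
    ...   | false = contradiction sat (falsified⇒¬satisfied (cong not τu ∷ αy ∷ []))

    exclusion⇒ : ∀ {i v} → SatisfiesClause [ τ , α ]′ (exclusion i v) →
                 α (combine i (neighbours v i)) ≡ true → τ v ≡ true → ⊥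
    exclusion⇒ sat αy τv = falsified⇒¬satisfied (cong not αy ∷ cong not τv ∷ []) sat

    independent : Satisfies [ τ , α ]′ formula → IsIndependent E τ
    independent sat u v adjacent τu τv with covers u | to Satisfies-formula⇔ sat
    ... | i , j , refl | impl , excl =
      exclusion⇒ (excl i v) (implication⇒ inPattern (impl i (neighbours v i) j) τu) τv
      where
      inPattern : decode (neighbours v i) j ≡ true
      inPattern = trans (decode-encode _ j) adjacent

  encodes : EncodesIS E formula
  encodes τ = mk⇔
    (uncurry (independent τ) ∘ to (satisfiable-restrict τ formula))
    (λ indep → from (satisfiable-restrict τ formula)
                 (witness τ , from Satisfies-formula⇔ (satisfies-implication τ , satisfies-exclusion τ indep)))

2*[1+⌊n/2⌋]≤2+n : ∀ n → 2 * suc ⌊ n /2⌋ ≤ 2 + n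
2*[1+⌊n/2⌋]≤2+n n = begin
  2 * suc h         ≡⟨ cong (suc h +_) (+-identityʳ (suc h)) ⟩
  suc h + suc h     ≡⟨ cong suc (+-suc h h) ⟩
  2 + (h + h)       ≤⟨ +-monoʳ-≤ 2 (+-monoʳ-≤ h (⌊n/2⌋≤⌈n/2⌉ n)) ⟩
  2 + (h + ⌈ n /2⌉) ≡⟨ cong (2 +_) (⌊n/2⌋+⌈n/2⌉≡n n) ⟩
  2 + n             ∎
  where
  open ≤-Reasoning
  h = ⌊ n /2⌋

n≤2*[1+⌊n/2⌋] : ∀ n → n ≤ 2 * suc ⌊ n /2⌋
n≤2*[1+⌊n/2⌋] n = begin
  n                 ≡⟨ ⌊n/2⌋+⌈n/2⌉≡n n ⟨
  h + ⌈ n /2⌉       ≤⟨ +-mono-≤ (n≤1+n h) (⌊n/2⌋-mono (n≤1+n (suc n))) ⟩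
  suc h + suc h     ≡⟨ cong (suc h +_) (+-identityʳ (suc h)) ⟨
  2 * suc h         ∎
  where
  open ≤-Reasoning
  h = ⌊ n /2⌋

2^⌊log2⌋[1+n]≤1+n : ∀ n (rec : Acc _<_ (suc n)) → 2 ^ ⌊log2⌋ (suc n) rec ≤ suc n
2^⌊log2⌋[1+n]≤1+n zero    _        = ≤-refl
2^⌊log2⌋[1+n]≤1+n (suc n) (acc rs) = ≤-trans (*-monoʳ-≤ 2 (2^⌊log2⌋[1+n]≤1+n ⌊ n /2⌋ _)) (2*[1+⌊n/2⌋]≤2+n n)

2^⌊log₂n⌋≤n : ∀ n .{{_ : NonZero n}} → 2 ^ ⌊log₂ n ⌋ ≤ n
2^⌊log₂n⌋≤n (suc n) = 2^⌊log2⌋[1+n]≤1+n n _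

n<2^n : ∀ n → n < 2 ^ n
n<2^n zero    = s≤s z≤n
n<2^n (suc n) = +-mono-≤ (m^n>0 2 n) (≤-trans (n<2^n n) (≤-reflexive (sym (+-identityʳ (2 ^ n)))))

module BlockParameters (n : ℕ) .{{_ : NonZero n}} where

  L k B : ℕ
  L = ⌊log₂ n ⌋
  k = suc ⌊ L /2⌋
  B = suc (n / k)

  n<B*k : n < B * k
  n<B*k = begin-strict
    n                  ≡⟨ m≡m%n+[m/n]*n n k ⟩
    n % k + n / k * k  <⟨ +-monoˡ-< (n / k * k) (m%n<n n k) ⟩
    B * k              ∎
    where open ≤-Reasoning

  2^k*2^k≤4n : 2 ^ k * 2 ^ k ≤ 4 * n
  2^k*2^k≤4n = begin
    2 ^ k * 2 ^ k      ≡⟨ ^-distribˡ-+-* 2 k k ⟨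
    2 ^ (k + k)        ≡⟨ cong (2 ^_) (cong (k +_) (+-identityʳ k)) ⟨
    2 ^ (2 * k)        ≤⟨ ^-monoʳ-≤ 2 (2*[1+⌊n/2⌋]≤2+n L) ⟩
    2 * (2 * 2 ^ L)    ≤⟨ *-monoʳ-≤ 2 (*-monoʳ-≤ 2 (2^⌊log₂n⌋≤n n)) ⟩
    2 * (2 * n)        ≡⟨ *-assoc 2 2 n ⟨
    4 * n              ∎
    where open ≤-Reasoning

  k*2^k≤4n : k * 2 ^ k ≤ 4 * n
  k*2^k≤4n = ≤-trans (*-monoˡ-≤ (2 ^ k) (<⇒≤ (n<2^n k))) 2^k*2^k≤4n

  B*k≤5n : B * k ≤ 5 * n
  B*k≤5n = begin
    k + n / k * k      ≤⟨ +-mono-≤ k≤4n (m/n*n≤m n k) ⟩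
    4 * n + n          ≡⟨ +-comm (4 * n) n ⟩
    5 * n              ∎
    where
    open ≤-Reasoning
    k≤4n : k ≤ 4 * n
    k≤4n = ≤-trans (m≤m*n k (2 ^ k) {{m^n≢0 2 k}}) k*2^k≤4n

  clauses*L≤50n² : (B * 2 ^ k * k + B * n) * L ≤ 50 * (n * n)
  clauses*L≤50n² = begin
    (B * 2 ^ k * k + B * n) * L                    ≤⟨ *-monoʳ-≤ (B * 2 ^ k * k + B * n) (n≤2*[1+⌊n/2⌋] L) ⟩
    (B * 2 ^ k * k + B * n) * (2 * k)              ≡⟨ regroup B (2 ^ k) k n ⟩
    2 * (B * k) * (k * 2 ^ k) + 2 * n * (B * k)    ≤⟨ +-mono-≤ (*-mono-≤ (*-monoʳ-≤ 2 B*k≤5n) k*2^k≤4n)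
                                                               (*-monoʳ-≤ (2 * n) B*k≤5n) ⟩
    2 * (5 * n) * (4 * n) + 2 * n * (5 * n)        ≡⟨ fifty n ⟩
    50 * (n * n)                                   ∎
    where
    open ≤-Reasoning
    regroup : ∀ b p k n → (b * p * k + b * n) * (2 * k) ≡ 2 * (b * k) * (k * p) + 2 * n * (b * k)
    regroup = solve-∀
    fifty : ∀ n → 2 * (5 * n) * (4 * n) + 2 * n * (5 * n) ≡ 50 * (n * n)
    fifty = solve-∀

theorem10 : ∃[ c ] (0 < c × ((n : ℕ) → 2 ≤ n → (E : Adj n) → IsSimpleGraph E →
              ∃[ m ] ∃[ F ] (EncodesIS {n} {m} E F × length F * ⌊log₂ n ⌋ ≤ c * (n * n))))
theorem10 = 50 , s≤s z≤n , encoding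
  where
  encoding : (n : ℕ) → 2 ≤ n → (E : Adj n) → IsSimpleGraph E →
             ∃[ m ] ∃[ F ] (EncodesIS {n} {m} E F × length F * ⌊log₂ n ⌋ ≤ 50 * (n * n))
  encoding n@(suc _) _ E _ =
    B * 2 ^ k , formula , encodes ,
    subst (λ ℓ → ℓ * L ≤ 50 * (n * n)) (sym length-formula) clauses*L≤50n²
    where
    open BlockParameters n
    open BlockEncoding {n} {B} {k} E cyclicBlock (cyclicBlock-covers (<⇒≤ n<B*k))
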